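{- Let $G_T=(V_T,E_T)$, $G_W=(V_W,E_W)$ be graphs, let $N\subseteq V_T$ be a node cover of $G_T$, and let $M$ be a partial match on $N$. Take candidate sets $C[u]=\{M(u)\}$ for $u\in N$ and, for $u\in V_T\setminus N$, $C[u]=\{c\in V_W:(u,c)\text{ is joinable to }M\}$, and let $G_C$ be the associated candidate structure. Then for all $w_1,w_2\in V_W$ not in the image of $M$: $w_1\sim_{N,M}w_2$ if and only if $w_1\sim_c w_2$.
   Context: A graph is a pair $G=(V,E)$ with $V$ finite and $E\subseteq V\times V$ (directed edges), with no self-loops. A node cover of $G_T$ is a set $N\subseteq V_T$ such that every edge of $E_T$ has at least one endpoint in $N$. A partial match on $N$ is an injective map $M:N\to V_W$ such that $(t_1,t_2)\in E_T$ with $t_1,t_2\in N$ implies $(M(t_1),M(t_2))\in E_W$. A pair $(v,c)\in V_T\times V_W$ is joinable to $M$ if for each $v_i\in N$: $(v_i,v)\in E_T\Rightarrow(M(v_i),c)\in E_W$ and $(v,v_i)\in E_T\Rightarrow(c,M(v_i))\in E_W$. Node cover equivalence: $w_1\sim_{N,M}w_2$ iff for all $u\in V_T\setminus N$, $w_1\in C[u]\Leftrightarrow w_2\in C[u]$. Two vertices $x,y$ of a directed graph $(V,E)$ are structurally equivalent ($x\sim_s y$) if for all $z\in V\setminus\{x,y\}$: $(z,x)\in E\Leftrightarrow(z,y)\in E$ and $(x,z)\in E\Leftrightarrow(y,z)\in E$, and moreover $(x,y)\in E\Leftrightarrow(y,x)\in E$. The candidate structure is the directed graph $G_C=(V_C,E_C)$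 with $V_C=\{(t,c):t\in V_T,\ c\in C[t]\}$ and $((t_1,c_1),(t_2,c_2))\in E_C$ iff $(t_1,t_2)\in E_T$ and $(c_1,c_2)\in E_W$. For $u\in V_T$, $c_1\sim_{c,u}c_2$ means: either $c_1,c_2\notin C[u]$, or $c_1,c_2\in C[u]$ and $(u,c_1)\sim_s(u,c_2)$ in $G_C$. Full candidate equivalence: $c_1\sim_c c_2$ iff $c_1\sim_{c,u}c_2$ for every $u\in V_T$. -}

module Defs where

open import Data.Nat using (ℕ)
open import Data.Fin using (Fin)
open import Data.Bool using (Bool; true; false)
open import Data.Product using (Σ; _×_; _,_; ∃)
open import Data.Sum using (_⊎_)
open import Relation.Nullary using (¬_)
open import Relation.Binary.PropositionalEquality using (_≡_)

record Graph : Set where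
  field
    size   : ℕ
    adj    : Fin size → Fin size → Bool
    noLoop : ∀ v → adj v v ≡ false

  V : Set
  V = Fin size

  E : V → V → Set
  E a b = adj a b ≡ true

open Graph public

_∈ₛ_ : ∀ {A : Set} → A → (A → Bool) → Set
v ∈ₛ N = N v ≡ true

IsNodeCover : (GT : Graph) → (V GT → Bool) → Set
IsNodeCover GT N = ∀ t₁ t₂ → E GT t₁ t₂ → (t₁ ∈ₛ N) ⊎ (t₂ ∈ₛ N)

-- M : N → V_W is represented by a total function whose values outside N are
-- irrelevant.  Partial match: injective on N and edge-preserving within N.
IsPartialMatch : (GT GW : Graph) → (V GT → Bool) → (V GT → V GW) → Set
IsPartialMatch GT GW N M =
  (∀ t₁ t₂ → t₁ ∈ₛ N → t₂ ∈ₛ N → M t₁ ≡ M t₂ → t₁ ≡ t₂) ×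
  (∀ t₁ t₂ → t₁ ∈ₛ N → t₂ ∈ₛ N → E GT t₁ t₂ → E GW (M t₁) (M t₂))

Joinable : (GT GW : Graph) → (V GT → Bool) → (V GT → V GW) → V GT → V GW → Set
Joinable GT GW N M v c =
  ∀ vᵢ → vᵢ ∈ₛ N →
    (E GT vᵢ v → E GW (M vᵢ) c) × (E GT v vᵢ → E GW c (M vᵢ))

InImage : (GT GW : Graph) → (V GT → Bool) → (V GT → V GW) → V GW → Set
InImage GT GW N M w = Σ (V GT) λ t → t ∈ₛ N × M t ≡ w

module Candidates (GT GW : Graph) (N : V GT → Bool) (M : V GT → V GW) where

  C : V GT → V GW → Set
  C u c = (u ∈ₛ N × c ≡ M u) ⊎ (¬ (u ∈ₛ N) × Joinable GT GW N M u c)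

  VC : Set
  VC = Σ (V GT × V GW) λ { (t , c) → C t c }

  EC : VC → VC → Set
  EC ((t₁ , c₁) , _) ((t₂ , c₂) , _) = E GT t₁ t₂ × E GW c₁ c₂

  _≐_ : VC → VC → Set
  (p , _) ≐ (q , _) = p ≡ q

  StructEquiv : VC → VC → Set
  StructEquiv x y =
    (∀ z → ¬ (z ≐ x) → ¬ (z ≐ y) →
       ((EC z x → EC z y) × (EC z y → EC z x)) ×
       ((EC x z → EC y z) × (EC y z → EC x z))) ×
    ((EC x y → EC y x) × (EC y x → EC x y))

  CandEquivAt : V GT → V GW → V GW → Set
  CandEquivAt u c₁ c₂ =
    (¬ C u c₁ × ¬ C u c₂) ⊎
    (Σ (C u c₁) λ h₁ → Σ (C u c₂) λ h₂ →
       StructEquiv ((u , c₁) , h₁) ((u , c₂) , h₂))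

  CandEquiv : V GW → V GW → Set
  CandEquiv c₁ c₂ = ∀ u → CandEquivAt u c₁ c₂

  NodeCoverEquiv : V GW → V GW → Set
  NodeCoverEquiv w₁ w₂ =
    ∀ u → ¬ (u ∈ₛ N) → (C u w₁ → C u w₂) × (C u w₂ → C u w₁)

-- For u outside the node cover every G_T-neighbour t of u lies in the cover, so the
-- only candidate of t is M t, and joinability of (u , c) says exactly that c is
-- adjacent to M t in the right direction.  Hence all candidates (u , c) have the same
-- neighbourhood in G_C, and (u , c₁) , (u , c₂) are never adjacent since G_T is
-- loopless: ∼_{c,u} just says that c₁ and c₂ are both candidates of u or both not.
-- For u in the cover, a vertex outside the image of M is never a candidate of u.
module Submission where

open import Defs
open import Data.Bool using (Bool; true)
import Data.Bool.Properties as Bool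
open import Data.Fin using (_≟_)
open import Data.Fin.Properties using (all?)
open import Data.Product using (_×_; _,_; proj₁; proj₂)
open import Data.Sum using (inj₁; inj₂)
open import Data.Empty using (⊥-elim)
open import Relation.Nullary using (¬_; Dec; yes; no; contradiction)
open import Relation.Nullary.Decidable using (_×-dec_; _⊎-dec_; _→-dec_; ¬?)
open import Relation.Binary.PropositionalEquality using (_≡_; sym; trans; subst)

¬E-loop : (G : Graph) (v : V G) → ¬ E G v v
¬E-loop G v e with trans (sym e) (noLoop G v)
... | ()

module _ (GT GW : Graph) (N : V GT → Bool) (M : V GT → V GW) where
  open Candidates GT GW N M

  joinable? : ∀ u c → Dec (Joinable GT GW N M u c)
  joinable? u c = all? λ t → (N t Bool.≟ true) →-dec
    (((adj GT t u Bool.≟ true) →-dec (adj GW (M t) c Bool.≟ true)) ×-dec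
     ((adj GT u t Bool.≟ true) →-dec (adj GW c (M t) Bool.≟ true)))

  candidate? : ∀ u c → Dec (C u c)
  candidate? u c =
    ((N u Bool.≟ true) ×-dec (c ≟ M u)) ⊎-dec (¬? (N u Bool.≟ true) ×-dec joinable? u c)

  candidate-in-cover : ∀ {t c} → t ∈ₛ N → C t c → c ≡ M t
  candidate-in-cover _  (inj₁ (_ , c≡Mt)) = c≡Mt
  candidate-in-cover t∈N (inj₂ (t∉N , _)) = contradiction t∈N t∉N

  candidate-outside-cover : ∀ {u c} → ¬ (u ∈ₛ N) → C u c → Joinable GT GW N M u c
  candidate-outside-cover u∉N (inj₁ (u∈N , _)) = contradiction u∈N u∉N
  candidate-outside-cover _   (inj₂ (_ , J)) = J

  ¬candidate-in-cover : ∀ {u w} → ¬ InImage GT GW N M w → u ∈ₛ N → ¬ C u w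
  ¬candidate-in-cover {u} w∉im u∈N h = w∉im (u , u∈N , sym (candidate-in-cover u∈N h))

  candEquivAt⇒⇔ : ∀ {u c₁ c₂} → CandEquivAt u c₁ c₂ → (C u c₁ → C u c₂) × (C u c₂ → C u c₁)
  candEquivAt⇒⇔ (inj₁ (¬h₁ , ¬h₂)) = (λ h₁ → contradiction h₁ ¬h₁) , (λ h₂ → contradiction h₂ ¬h₂)
  candEquivAt⇒⇔ (inj₂ (h₁ , h₂ , _)) = (λ _ → h₂) , (λ _ → h₁)

  candEquivAt-in-cover : ∀ {u w₁ w₂} → ¬ InImage GT GW N M w₁ → ¬ InImage GT GW N M w₂ →
                         u ∈ₛ N → CandEquivAt u w₁ w₂
  candEquivAt-in-cover w₁∉im w₂∉im u∈N =
    inj₁ (¬candidate-in-cover w₁∉im u∈N , ¬candidate-in-cover w₂∉im u∈N)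

  module _ (cover : IsNodeCover GT N) where

    joinable-edge-in : ∀ {t c u w} → ¬ (u ∈ₛ N) → Joinable GT GW N M u w → C t c →
                       E GT t u → E GW c w
    joinable-edge-in {t} {u = u} {w} u∉N J h e with cover t u e
    ... | inj₁ t∈N = subst (λ x → E GW x w) (sym (candidate-in-cover t∈N h)) (proj₁ (J t t∈N) e)
    ... | inj₂ u∈N = contradiction u∈N u∉N

    joinable-edge-out : ∀ {t c u w} → ¬ (u ∈ₛ N) → Joinable GT GW N M u w → C t c →
                        E GT u t → E GW w c
    joinable-edge-out {t} {u = u} {w} u∉N J h e with cover u t e
    ... | inj₁ u∈N = contradiction u∈N u∉N
    ... | inj₂ t∈N = subst (E GW w) (sym (candidate-in-cover t∈N h)) (proj₂ (J t t∈N) e)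

    candidates-outside-cover-structEquiv :
      ∀ {u w₁ w₂} → ¬ (u ∈ₛ N) → (h₁ : C u w₁) (h₂ : C u w₂) →
      StructEquiv ((u , w₁) , h₁) ((u , w₂) , h₂)
    candidates-outside-cover-structEquiv {u} {w₁} {w₂} u∉N h₁ h₂ = same-neighbours , no-edge , no-edge
      where
        J₁ : Joinable GT GW N M u w₁
        J₁ = candidate-outside-cover u∉N h₁
        J₂ : Joinable GT GW N M u w₂
        J₂ = candidate-outside-cover u∉N h₂

        in-edge : ∀ {w} → Joinable GT GW N M u w → ∀ {t c} → C t c → E GT t u →
                  E GT t u × E GW c w
        in-edge J h e = e , joinable-edge-in u∉N J h e

        out-edge : ∀ {w} → Joinable GT GW N M u w → ∀ {t c} → C t c → E GT u t →
                   E GT u t × E GW w c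
        out-edge J h e = e , joinable-edge-out u∉N J h e

        x y : VC
        x = (u , w₁) , h₁
        y = (u , w₂) , h₂

        same-neighbours : ∀ z → ¬ (z ≐ x) → ¬ (z ≐ y) →
          ((EC z x → EC z y) × (EC z y → EC z x)) × ((EC x z → EC y z) × (EC y z → EC x z))
        same-neighbours ((t , c) , h) _ _ =
          ((λ (e , _) → in-edge J₂ h e) , (λ (e , _) → in-edge J₁ h e)) ,
          ((λ (e , _) → out-edge J₂ h e) , (λ (e , _) → out-edge J₁ h e))

        no-edge : ∀ {A : Set} {c c′} → E GT u u × E GW c c′ → A
        no-edge (e , _) = ⊥-elim (¬E-loop GT u e)

    ⇔⇒candEquivAt-outside-cover : ∀ {u w₁ w₂} → ¬ (u ∈ₛ N) →
      (C u w₁ → C u w₂) × (C u w₂ → C u w₁) → CandEquivAt u w₁ w₂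
    ⇔⇒candEquivAt-outside-cover {u} {w₁} u∉N (to , from) with candidate? u w₁
    ... | yes h₁ = inj₂ (h₁ , to h₁ , candidates-outside-cover-structEquiv u∉N h₁ (to h₁))
    ... | no ¬h₁ = inj₁ (¬h₁ , λ h₂ → ¬h₁ (from h₂))

proposition9 : (GT GW : Graph) (N : V GT → Bool) (M : V GT → V GW) →
    IsNodeCover GT N → IsPartialMatch GT GW N M →
    (w₁ w₂ : V GW) → ¬ InImage GT GW N M w₁ → ¬ InImage GT GW N M w₂ →
    (Candidates.NodeCoverEquiv GT GW N M w₁ w₂ → Candidates.CandEquiv GT GW N M w₁ w₂) ×
    (Candidates.CandEquiv GT GW N M w₁ w₂ → Candidates.NodeCoverEquiv GT GW N M w₁ w₂)
proposition9 GT GW N M cover _ w₁ w₂ w₁∉im w₂∉im = nodeCover⇒cand , cand⇒nodeCover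
  where
    open Candidates GT GW N M

    nodeCover⇒cand : NodeCoverEquiv w₁ w₂ → CandEquiv w₁ w₂
    nodeCover⇒cand nce u with N u Bool.≟ true
    ... | yes u∈N = candEquivAt-in-cover GT GW N M w₁∉im w₂∉im u∈N
    ... | no  u∉N = ⇔⇒candEquivAt-outside-cover GT GW N M cover u∉N (nce u u∉N)

    cand⇒nodeCover : CandEquiv w₁ w₂ → NodeCoverEquiv w₁ w₂
    cand⇒nodeCover ce u _ = candEquivAt⇒⇔ GT GW N M (ce u)
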